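{- (Alternation Theorem, smaller vs. larger.) For every integer $\ell \ge 1$ there is a first-order $\tau_{\mathsf{ord}}$-sentence $\sigma_\ell$ in prenex form separating $L_{\le \ell}$ from $L_{>\ell}$ that has exactly $q^*(\ell)$ quantifiers (and so at most $\log(\ell)+2$ quantifiers), and whose quantifier prefix strictly alternates between $\exists$ and $\forall$ and ends with $\forall$.
   Context: Let $\tau_{\mathsf{ord}} = \langle <; \mathsf{min}, \mathsf{max}\rangle$ with $<$ binary and $\mathsf{min},\mathsf{max}$ constants. For $\ell \ge 1$, $L_\ell$ denotes the linear order on $\ell+1$ elements with $\mathsf{min},\mathsf{max}$ interpreted as its first and last elements ($\ell$ is its length); $L_{\le\ell}=\{L_1,\dots,L_\ell\}$, $L_{>\ell}=\{L_m: m>\ell\}$. A sentence separates $\mathcal{A}$ from $\mathcal{B}$ if it is true in all structures of $\mathcal{A}$ and false in all structures of $\mathcal{B}$. $\log$ is base 2. The functions $q^*_\forall, q^*_\exists:\mathbb{N}_{\ge1}\to\mathbb{N}$ (the number of rounds used by the paper's "closest-to-midpoint with alternation" Spoiler strategy starting with a universal, resp. existential, move) satisfy and are determined by: $q^*_\forall(1)=1$, $q^*_\exists(1)=2$, $q^*_\forall(2)=2$; $q^*_\exists(2m)=q^*_\forall(m)+1$ and $q^*_\exists(2m+1)=q^*_\forall(m+1)+1$ for $m\ge1$; $q^*_\forall(2m)=q^*_\exists(m)+1$ for $m\ge2$; $q^*_\forall(2m+1)=q^*_\exists(m)+1$ for $m\ge1$. Finally $q^*(\ell)=\min(q^*_\forall(\ell),q^*_\exists(\ell))$.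 -}

module Defs where

open import Data.Nat using (ℕ; zero; suc; _⊓_; ⌊_/2⌋; ⌈_/2⌉)
open import Data.Fin using (Fin; fromℕ) renaming (zero to fzero; _<_ to _<ᶠ_)
open import Data.List using (List; []; _∷_)
open import Data.Product using (Σ; _×_)
open import Data.Sum using (_⊎_)
open import Data.Empty using (⊥)
open import Data.Unit using (⊤)
open import Relation.Binary.PropositionalEquality using (_≡_; _≢_)
open import Relation.Nullary using (¬_)

data Term (n : ℕ) : Set where
  var  : Fin n → Term n
  tmin : Term n
  tmax : Term n

data QF (n : ℕ) : Set where
  ⊤'   : QF n
  ⊥'   : QF n
  _<'_ : Term n → Term n → QF n
  _='_ : Term n → Term n → QF n
  ¬'_  : QF n → QF n
  _∧'_ : QF n → QF n → QF n
  _∨'_ : QF n → QF n → QF n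

data Prenex (n : ℕ) : Set where
  matrix : QF n → Prenex n
  ∀'     : Prenex (suc n) → Prenex n
  ∃'     : Prenex (suc n) → Prenex n

PrenexSentence : Set
PrenexSentence = Prenex 0

data Quant : Set where
  Q∀ Q∃ : Quant

prefix : ∀ {n} → Prenex n → List Quant
prefix (matrix _) = []
prefix (∀' φ)     = Q∀ ∷ prefix φ
prefix (∃' φ)     = Q∃ ∷ prefix φ

data Alternating : List Quant → Set where
  alt-[]  : Alternating []
  alt-[_] : ∀ q → Alternating (q ∷ [])
  alt-∷   : ∀ {q q' qs} → q ≢ q' → Alternating (q' ∷ qs) → Alternating (q ∷ q' ∷ qs)

-- The structure L_ℓ: the linear order on ℓ+1 elements {0,…,ℓ},
-- min = 0, max = ℓ.

Env : ℕ → ℕ → Set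
Env ℓ n = Fin n → Fin (suc ℓ)

⟦_⟧t : ∀ {ℓ n} → Term n → Env ℓ n → Fin (suc ℓ)
⟦ var i ⟧t ρ = ρ i
⟦_⟧t {ℓ} tmin ρ = fzero
⟦_⟧t {ℓ} tmax ρ = fromℕ ℓ

_⊨qf_[_] : ∀ {n} (ℓ : ℕ) → QF n → Env ℓ n → Set
ℓ ⊨qf ⊤' [ ρ ] = ⊤
ℓ ⊨qf ⊥' [ ρ ] = ⊥
ℓ ⊨qf (s <' t) [ ρ ] = ⟦ s ⟧t ρ <ᶠ ⟦ t ⟧t ρ
ℓ ⊨qf (s =' t) [ ρ ] = ⟦ s ⟧t ρ ≡ ⟦ t ⟧t ρ
ℓ ⊨qf (¬' φ) [ ρ ] = ¬ (ℓ ⊨qf φ [ ρ ])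
ℓ ⊨qf (φ ∧' ψ) [ ρ ] = (ℓ ⊨qf φ [ ρ ]) × (ℓ ⊨qf ψ [ ρ ])
ℓ ⊨qf (φ ∨' ψ) [ ρ ] = (ℓ ⊨qf φ [ ρ ]) ⊎ (ℓ ⊨qf ψ [ ρ ])

extend : ∀ {ℓ n} → Fin (suc ℓ) → Env ℓ n → Env ℓ (suc n)
extend a ρ fzero    = a
extend a ρ (Fin.suc i) = ρ i

_⊨_[_] : ∀ {n} (ℓ : ℕ) → Prenex n → Env ℓ n → Set
ℓ ⊨ matrix φ [ ρ ] = ℓ ⊨qf φ [ ρ ]
ℓ ⊨ ∀' φ [ ρ ] = (a : Fin (suc ℓ)) → ℓ ⊨ φ [ extend a ρ ]
ℓ ⊨ ∃' φ [ ρ ] = Σ (Fin (suc ℓ)) λ a → ℓ ⊨ φ [ extend a ρ ]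

emptyEnv : ∀ {ℓ} → Env ℓ 0
emptyEnv ()

_⊨_ : ℕ → PrenexSentence → Set
ℓ ⊨ σ = ℓ ⊨ σ [ emptyEnv ]

-- q*_∀, q*_∃ (fuel-based; fuel = argument suffices since arguments shrink)
--   q∀(1)=1, q∀(2)=2, q∀(n)=q∃(⌊n/2⌋)+1 for n ≥ 3
--   q∃(1)=2,          q∃(n)=q∀(⌈n/2⌉)+1 for n ≥ 2
-- (values at 0 are junk and never used)

q∀f q∃f : ℕ → ℕ → ℕ
q∀f zero _ = 0
q∀f (suc f) zero = 0
q∀f (suc f) 1 = 1
q∀f (suc f) 2 = 2
q∀f (suc f) n@(suc (suc (suc _))) = suc (q∃f f ⌊ n /2⌋)
q∃f zero _ = 0
q∃f (suc f) zero = 0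
q∃f (suc f) 1 = 2
q∃f (suc f) n@(suc (suc _)) = suc (q∀f f ⌈ n /2⌉)

q*∀ q*∃ q* : ℕ → ℕ
q*∀ n = q∀f n n
q*∃ n = q∃f n n
q* n = q*∀ n ⊓ q*∃ n

{-# OPTIONS --safe #-}
module Submission where

-- The sentence for ℓ states max ≤ min + ℓ by bisection.  Below a universal z,
-- t ≤ s + (d+1) holds iff every z strictly between s and t lies within ⌊d/2⌋ of s
-- or within ⌈d/2⌉ of t; below an existential w, t ≤ s + d holds iff some w cuts
-- [s,t] into pieces of lengths at most ⌈d/2⌉ and ⌊d/2⌋.  Each piece is a statement
-- of the same kind, and which piece matters is decided by the side on which the
-- next quantified point falls, so the two merge into one prenex formula and every
-- quantifier halves the distance.  Thus k alternating quantifiers ending in ∀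
-- handle distances up to capacity k = 1, 2, 5, 10, 21, …, and induction along the
-- recurrences of q*∀ and q*∃ gives ℓ ≤ capacity (q* ℓ) and the logarithmic bound.

open import Defs
open import Data.Nat using (ℕ; zero; suc; _≤_; _<_; _+_; _*_; _^_; ⌊_/2⌋; ⌈_/2⌉; z≤n; s≤s; z<s; _≤?_; _<?_)
open import Data.Nat.Properties
open import Data.Nat.Logarithm using (⌊log₂_⌋; ⌊log₂⌋-mono-≤; ⌊log₂[2^n]⌋≡n)
open import Data.Fin using (Fin; toℕ; fromℕ<) renaming (zero to fzero; suc to fsuc)
import Data.Fin.Properties as Fin
open import Data.List using (List; []; _∷_; length; last)
open import Data.List.Properties using (∷-injectiveʳ)
open import Data.Maybe using (just)
open import Data.Product using (Σ; _×_; _,_; proj₁; proj₂)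
open import Data.Product.Function.Dependent.Propositional using (Σ-⇔)
open import Data.Product.Function.NonDependent.Propositional using (_×-⇔_)
open import Data.Sum using (_⊎_; inj₁; inj₂; [_,_])
open import Data.Sum.Function.Propositional using (_⊎-⇔_)
open import Data.Empty using (⊥-elim)
open import Data.Unit using (tt)
open import Function.Base using (id; _∘_)
open import Function.Bundles using (_⇔_; mk⇔; Equivalence)
open import Function.Construct.Composition using (_⇔-∘_)
open import Function.Construct.Identity using (⇔-id; ↠-id)
open import Function.Related.Propositional using (≡⇒)
open import Function.Related.TypeIsomorphisms using (¬-cong-⇔; →-cong-⇔)
open import Relation.Binary.PropositionalEquality using (_≡_; _≢_; refl; sym; trans; cong; subst)
open import Relation.Nullary using (¬_; Dec; yes; no)
open import Relation.Nullary.Decidable using (¬?; _×-dec_; _⊎-dec_; toSum)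

open Equivalence using (to; from)
open ≤-Reasoning

private
  variable
    m n : ℕ

dual : Quant → Quant
dual Q∀ = Q∃
dual Q∃ = Q∀

dual-involutive : ∀ q → dual (dual q) ≡ q
dual-involutive Q∀ = refl
dual-involutive Q∃ = refl

q≢dual[q] : ∀ q → q ≢ dual q
q≢dual[q] Q∀ ()
q≢dual[q] Q∃ ()

alternation : Quant → ℕ → List Quant
alternation q zero    = []
alternation q (suc k) = q ∷ alternation (dual q) k

alternation-alternating : ∀ q k → Alternating (alternation q k)
alternation-alternating q zero          = alt-[]
alternation-alternating q (suc zero)    = alt-[ q ]
alternation-alternating q (suc (suc k)) =
  alt-∷ (q≢dual[q] q) (alternation-alternating (dual q) (suc k))

length-alternation : ∀ q k → length (alternation q k) ≡ k
length-alternation q zero    = refl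
length-alternation q (suc k) = cong suc (length-alternation (dual q) k)

quantify : Quant → Prenex (suc n) → Prenex n
quantify Q∀ = ∀'
quantify Q∃ = ∃'

prefix-quantify : ∀ q (φ : Prenex (suc n)) → prefix (quantify q φ) ≡ q ∷ prefix φ
prefix-quantify Q∀ φ = refl
prefix-quantify Q∃ φ = refl

weakenTerm : Term n → Term (suc n)
weakenTerm (var i) = var (fsuc i)
weakenTerm tmin    = tmin
weakenTerm tmax    = tmax

weakenQF : QF n → QF (suc n)
weakenQF ⊤'       = ⊤'
weakenQF ⊥'       = ⊥'
weakenQF (s <' t) = weakenTerm s <' weakenTerm t
weakenQF (s =' t) = weakenTerm s =' weakenTerm t
weakenQF (¬' C)   = ¬' weakenQF C
weakenQF (C ∧' D) = weakenQF C ∧' weakenQF D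
weakenQF (C ∨' D) = weakenQF C ∨' weakenQF D

padded : List Quant → QF n → Prenex n
padded []       C = matrix C
padded (q ∷ qs) C = quantify q (padded qs (weakenQF C))

prefix-padded : ∀ qs (C : QF n) → prefix (padded qs C) ≡ qs
prefix-padded []       C = refl
prefix-padded (q ∷ qs) C =
  trans (prefix-quantify q (padded qs (weakenQF C))) (cong (q ∷_) (prefix-padded qs (weakenQF C)))

-- A condition on the free variables commutes with the quantifiers, so two
-- formulas with the same prefix merge under that prefix.  The last clause,
-- for different prefixes, is junk.
if_then_else_ : QF n → Prenex n → Prenex n → Prenex n
if C then matrix M else matrix M' = matrix ((C ∧' M) ∨' ((¬' C) ∧' M'))
if C then ∀' φ     else ∀' ψ      = ∀' (if weakenQF C then φ else ψ)
if C then ∃' φ     else ∃' ψ      = ∃' (if weakenQF C then φ else ψ)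
if C then φ        else _         = φ

prefix-if : ∀ (C : QF n) φ ψ → prefix φ ≡ prefix ψ → prefix (if C then φ else ψ) ≡ prefix φ
prefix-if C (matrix _) (matrix _) _  = refl
prefix-if C (∀' φ)     (∀' ψ)     eq = cong (Q∀ ∷_) (prefix-if (weakenQF C) φ ψ (∷-injectiveʳ eq))
prefix-if C (∃' φ)     (∃' ψ)     eq = cong (Q∃ ∷_) (prefix-if (weakenQF C) φ ψ (∷-injectiveʳ eq))
prefix-if C (matrix _) (∀' _)     ()
prefix-if C (matrix _) (∃' _)     ()
prefix-if C (∀' _)     (matrix _) ()
prefix-if C (∀' _)     (∃' _)     ()
prefix-if C (∃' _)     (matrix _) ()
prefix-if C (∃' _)     (∀' _)     ()

_⇒'_ : QF n → Prenex n → Prenex n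
C ⇒' φ = if C then φ else padded (prefix φ) ⊤'

prefix-⇒' : ∀ (C : QF n) φ → prefix (C ⇒' φ) ≡ prefix φ
prefix-⇒' C φ = prefix-if C φ (padded (prefix φ) ⊤') (sym (prefix-padded (prefix φ) ⊤'))

Π-⇔ : ∀ {I : Set} {A B : I → Set} → (∀ i → A i ⇔ B i) → ((i : I) → A i) ⇔ ((i : I) → B i)
Π-⇔ A⇔B = mk⇔ (λ f i → to (A⇔B i) (f i)) (λ f i → from (A⇔B i) (f i))

cases-⇔ : ∀ {A A' B B' C C' : Set} → A ⇔ A' → B ⇔ B' → C ⇔ C' →
          ((A → B) × (¬ A → C)) ⇔ ((A' → B') × (¬ A' → C'))
cases-⇔ A⇔A' B⇔B' C⇔C' = →-cong-⇔ A⇔A' B⇔B' ×-⇔ →-cong-⇔ (¬-cong-⇔ A⇔A') C⇔C'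

cases-⊎ : ∀ {A B C : Set} → Dec A → ((A × B) ⊎ (¬ A × C)) ⇔ ((A → B) × (¬ A → C))
cases-⊎ A? = mk⇔
  [ (λ (a , b) → (λ _ → b) , (λ ¬a → ⊥-elim (¬a a))) , (λ (¬a , c) → (λ a → ⊥-elim (¬a a)) , (λ _ → c)) ]
  (λ (f , g) → [ (λ a → inj₁ (a , f a)) , (λ ¬a → inj₂ (¬a , g ¬a)) ] (toSum A?))

cases-Π : ∀ {I A : Set} {B C : I → Set} →
          ((i : I) → (A → B i) × (¬ A → C i)) ⇔ ((A → (i : I) → B i) × (¬ A → (i : I) → C i))
cases-Π = mk⇔ (λ f → (λ a i → proj₁ (f i) a) , (λ ¬a i → proj₂ (f i) ¬a))
              (λ (g , h) i → (λ a → g a i) , (λ ¬a → h ¬a i))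

cases-Σ : ∀ {I A : Set} {B C : I → Set} → Dec A →
          Σ I (λ i → (A → B i) × (¬ A → C i)) ⇔ ((A → Σ I B) × (¬ A → Σ I C))
cases-Σ A? = mk⇔
  (λ (i , g , h) → (λ a → i , g a) , (λ ¬a → i , h ¬a))
  (λ (g , h) → [ (λ a → let i , b = g a in i , (λ _ → b) , (λ ¬a → ⊥-elim (¬a a)))
               , (λ ¬a → let i , c = h ¬a in i , (λ a → ⊥-elim (¬a a)) , (λ _ → c)) ] (toSum A?))

val : Term n → Env m n → ℕ
val s ρ = toℕ (⟦ s ⟧t ρ)

val≤m : ∀ (s : Term n) (ρ : Env m n) → val s ρ ≤ m
val≤m s ρ = Fin.toℕ≤pred[n] (⟦ s ⟧t ρ)

⟦weakenTerm⟧ : ∀ (s : Term n) a (ρ : Env m n) → ⟦ weakenTerm s ⟧t (extend a ρ) ≡ ⟦ s ⟧t ρ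
⟦weakenTerm⟧ (var i) a ρ = refl
⟦weakenTerm⟧ tmin    a ρ = refl
⟦weakenTerm⟧ tmax    a ρ = refl

val-weaken : ∀ (s : Term n) a (ρ : Env m n) → val (weakenTerm s) (extend a ρ) ≡ val s ρ
val-weaken s a ρ = cong toℕ (⟦weakenTerm⟧ s a ρ)

⊨qf-weaken : ∀ (C : QF n) a (ρ : Env m n) → m ⊨qf weakenQF C [ extend a ρ ] ⇔ m ⊨qf C [ ρ ]
⊨qf-weaken ⊤'       a ρ = ⇔-id _
⊨qf-weaken ⊥'       a ρ = ⇔-id _
⊨qf-weaken (s <' t) a ρ rewrite ⟦weakenTerm⟧ s a ρ | ⟦weakenTerm⟧ t a ρ = ⇔-id _
⊨qf-weaken (s =' t) a ρ rewrite ⟦weakenTerm⟧ s a ρ | ⟦weakenTerm⟧ t a ρ = ⇔-id _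
⊨qf-weaken (¬' C)   a ρ = ¬-cong-⇔ (⊨qf-weaken C a ρ)
⊨qf-weaken (C ∧' D) a ρ = ⊨qf-weaken C a ρ ×-⇔ ⊨qf-weaken D a ρ
⊨qf-weaken (C ∨' D) a ρ = ⊨qf-weaken C a ρ ⊎-⇔ ⊨qf-weaken D a ρ

⊨qf? : ∀ (C : QF n) (ρ : Env m n) → Dec (m ⊨qf C [ ρ ])
⊨qf? ⊤'       ρ = yes tt
⊨qf? ⊥'       ρ = no λ ()
⊨qf? (s <' t) ρ = ⟦ s ⟧t ρ Fin.<? ⟦ t ⟧t ρ
⊨qf? (s =' t) ρ = ⟦ s ⟧t ρ Fin.≟ ⟦ t ⟧t ρ
⊨qf? (¬' C)   ρ = ¬? (⊨qf? C ρ)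
⊨qf? (C ∧' D) ρ = ⊨qf? C ρ ×-dec ⊨qf? D ρ
⊨qf? (C ∨' D) ρ = ⊨qf? C ρ ⊎-dec ⊨qf? D ρ

⊨-quantify-vacuous : ∀ q (φ : Prenex (suc n)) (ρ : Env m n) {A : Set} →
                     (∀ a → m ⊨ φ [ extend a ρ ] ⇔ A) → m ⊨ quantify q φ [ ρ ] ⇔ A
⊨-quantify-vacuous Q∀ φ ρ φ⇔A = mk⇔ (λ ∀φ → to (φ⇔A fzero) (∀φ fzero)) (λ x a → from (φ⇔A a) x)
⊨-quantify-vacuous Q∃ φ ρ φ⇔A = mk⇔ (λ (a , φa) → to (φ⇔A a) φa) (λ x → fzero , from (φ⇔A fzero) x)

⊨-padded : ∀ qs (C : QF n) (ρ : Env m n) → m ⊨ padded qs C [ ρ ] ⇔ m ⊨qf C [ ρ ]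
⊨-padded []       C ρ = ⇔-id _
⊨-padded (q ∷ qs) C ρ = ⊨-quantify-vacuous q (padded qs (weakenQF C)) ρ
  λ a → ⊨qf-weaken C a ρ ⇔-∘ ⊨-padded qs (weakenQF C) (extend a ρ)

⊨-if : ∀ (C : QF n) φ ψ (ρ : Env m n) → prefix φ ≡ prefix ψ →
       m ⊨ if C then φ else ψ [ ρ ] ⇔
       ((m ⊨qf C [ ρ ] → m ⊨ φ [ ρ ]) × (¬ m ⊨qf C [ ρ ] → m ⊨ ψ [ ρ ]))
⊨-if C (matrix M) (matrix M') ρ _  = cases-⊎ (⊨qf? C ρ)
⊨-if C (∀' φ)     (∀' ψ)      ρ eq = cases-Π ⇔-∘ Π-⇔ λ a →
  cases-⇔ (⊨qf-weaken C a ρ) (⇔-id _) (⇔-id _) ⇔-∘ ⊨-if (weakenQF C) φ ψ (extend a ρ) (∷-injectiveʳ eq)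
⊨-if C (∃' φ)     (∃' ψ)      ρ eq = cases-Σ (⊨qf? C ρ) ⇔-∘ Σ-⇔ (↠-id _)
  (cases-⇔ (⊨qf-weaken C _ ρ) (⇔-id _) (⇔-id _) ⇔-∘ ⊨-if (weakenQF C) φ ψ (extend _ ρ) (∷-injectiveʳ eq))
⊨-if C (matrix _) (∀' _)     ρ ()
⊨-if C (matrix _) (∃' _)     ρ ()
⊨-if C (∀' _)     (matrix _) ρ ()
⊨-if C (∀' _)     (∃' _)     ρ ()
⊨-if C (∃' _)     (matrix _) ρ ()
⊨-if C (∃' _)     (∀' _)     ρ ()

⊨-⇒' : ∀ (C : QF n) φ (ρ : Env m n) → m ⊨ C ⇒' φ [ ρ ] ⇔ (m ⊨qf C [ ρ ] → m ⊨ φ [ ρ ])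
⊨-⇒' C φ ρ = mk⇔ (proj₁ ∘ to cases) (λ f → from cases (f , λ _ → from (⊨-padded (prefix φ) ⊤' ρ) tt))
  where cases = ⊨-if C φ (padded (prefix φ) ⊤') ρ (sym (prefix-padded (prefix φ) ⊤'))

∀-Fin⇔ : ∀ {P : ℕ → Set} → ((v : Fin (suc m)) → P (toℕ v)) ⇔ (∀ V → V ≤ m → P V)
∀-Fin⇔ {P = P} = mk⇔
  (λ f V V≤m → subst P (Fin.toℕ-fromℕ< (s≤s V≤m)) (f (fromℕ< (s≤s V≤m))))
  (λ f v → f (toℕ v) (Fin.toℕ≤pred[n] v))

∃-Fin⇔ : ∀ {P : ℕ → Set} → Σ (Fin (suc m)) (P ∘ toℕ) ⇔ (Σ ℕ λ V → V ≤ m × P V)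
∃-Fin⇔ {P = P} = mk⇔
  (λ (v , p) → toℕ v , Fin.toℕ≤pred[n] v , p)
  (λ (V , V≤m , p) → fromℕ< (s≤s V≤m) , subst P (sym (Fin.toℕ-fromℕ< (s≤s V≤m))) p)

⌈n/2⌉+⌊n/2⌋≡n : ∀ n → ⌈ n /2⌉ + ⌊ n /2⌋ ≡ n
⌈n/2⌉+⌊n/2⌋≡n n = trans (+-comm ⌈ n /2⌉ ⌊ n /2⌋) (⌊n/2⌋+⌈n/2⌉≡n n)

1+m+⌊n/2⌋+⌈n/2⌉≡m+1+n : ∀ m n → suc (m + ⌊ n /2⌋) + ⌈ n /2⌉ ≡ m + suc n
1+m+⌊n/2⌋+⌈n/2⌉≡m+1+n m n = begin-equality
  suc (m + ⌊ n /2⌋) + ⌈ n /2⌉   ≡⟨ cong suc (+-assoc m ⌊ n /2⌋ ⌈ n /2⌉) ⟩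
  suc (m + (⌊ n /2⌋ + ⌈ n /2⌉)) ≡⟨ cong (suc ∘ (m +_)) (⌊n/2⌋+⌈n/2⌉≡n n) ⟩
  suc (m + n)                   ≡⟨ +-suc m n ⟨
  m + suc n                     ∎

⌈n/2⌉≤m : ∀ {n m} → n ≤ m + m → ⌈ n /2⌉ ≤ m
⌈n/2⌉≤m {n} {m} n≤2m = subst (⌈ n /2⌉ ≤_) (sym (n≡⌈n+n/2⌉ m)) (⌈n/2⌉-mono n≤2m)

⌊n/2⌋≤m : ∀ {n m} → n ≤ m + m → ⌊ n /2⌋ ≤ m
⌊n/2⌋≤m {n} n≤2m = ≤-trans (⌊n/2⌋≤⌈n/2⌉ n) (⌈n/2⌉≤m n≤2m)

m≤n+0⇒m≤n : ∀ {m n} → m ≤ n + 0 → m ≤ n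
m≤n+0⇒m≤n {n = n} = subst (_ ≤_) (+-identityʳ n)

NearEnd : ℕ → ℕ → ℕ → ℕ → Set
NearEnd zero    S Z T = T ≤ S
NearEnd (suc d) S Z T = S < Z → Z < T → Z ≤ S + ⌊ d /2⌋ ⊎ T ≤ Z + ⌈ d /2⌉

≤⇒nearEnd : ∀ d {S Z T} → T ≤ S + d → NearEnd d S Z T
≤⇒nearEnd zero    T≤S+0 = m≤n+0⇒m≤n T≤S+0
≤⇒nearEnd (suc d) {S} {Z} {T} T≤S+1+d _ _ with Z ≤? S + ⌊ d /2⌋
... | yes Z≤ = inj₁ Z≤
... | no  Z≰ = inj₂ (begin
  T                             ≤⟨ T≤S+1+d ⟩
  S + suc d                     ≡⟨ 1+m+⌊n/2⌋+⌈n/2⌉≡m+1+n S d ⟨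
  suc (S + ⌊ d /2⌋) + ⌈ d /2⌉   ≤⟨ +-monoˡ-≤ ⌈ d /2⌉ (≰⇒> Z≰) ⟩
  Z + ⌈ d /2⌉                   ∎)

-- The second hypothesis only matters for d = 0, where NearEnd ignores the point.
nearEnd⇒≤ : ∀ d {S T} → (∀ Z → S < Z → Z < T → NearEnd d S Z T) →
            (S < T → Σ ℕ λ Z → NearEnd d S Z T) → T ≤ S + d
nearEnd⇒≤ zero {S} {T} _ some with S <? T
... | yes S<T = ≤-trans (proj₂ (some S<T)) (m≤m+n S 0)
... | no  S≮T = ≤-trans (≮⇒≥ S≮T) (m≤m+n S 0)
nearEnd⇒≤ (suc d) {S} {T} all _ with T ≤? S + suc d
... | yes T≤ = T≤
... | no  T≰ = ⊥-elim ([ 1+n≰n , T≰ ∘ (λ T≤ → ≤-trans T≤ (≤-reflexive Z+⌈d/2⌉≡S+1+d)) ]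
                         (all Z S<Z Z<T S<Z Z<T))
  where
  Z = suc (S + ⌊ d /2⌋)
  Z+⌈d/2⌉≡S+1+d = 1+m+⌊n/2⌋+⌈n/2⌉≡m+1+n S d
  S<Z : S < Z
  S<Z = s≤s (m≤m+n S ⌊ d /2⌋)
  Z<T : Z < T
  Z<T = ≤-<-trans (≤-trans (m≤m+n Z ⌈ d /2⌉) (≤-reflexive Z+⌈d/2⌉≡S+1+d)) (≰⇒> T≰)

¬between⇔nearEnd-one : ∀ {S Z T} → (¬ (S < Z × Z < T)) ⇔ NearEnd 1 S Z T
¬between⇔nearEnd-one = mk⇔
  (λ ¬between S<Z Z<T → ⊥-elim (¬between (S<Z , Z<T)))
  (λ near (S<Z , Z<T) → [ <⇒≱ S<Z ∘ m≤n+0⇒m≤n , <⇒≱ Z<T ∘ m≤n+0⇒m≤n ] (near S<Z Z<T))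

SplitAt : ℕ → ℕ → ℕ → ℕ → Set
SplitAt d S W T = W ≤ S + ⌈ d /2⌉ × T ≤ W + ⌊ d /2⌋

splitAt⇒≤ : ∀ d {S W T} → SplitAt d S W T → T ≤ S + d
splitAt⇒≤ d {S} {W} {T} (W≤ , T≤) = begin
  T                         ≤⟨ T≤ ⟩
  W + ⌊ d /2⌋               ≤⟨ +-monoˡ-≤ ⌊ d /2⌋ W≤ ⟩
  S + ⌈ d /2⌉ + ⌊ d /2⌋     ≡⟨ +-assoc S ⌈ d /2⌉ ⌊ d /2⌋ ⟩
  S + (⌈ d /2⌉ + ⌊ d /2⌋)   ≡⟨ cong (S +_) (⌈n/2⌉+⌊n/2⌋≡n d) ⟩
  S + d                     ∎

≤⇒splitAt : ∀ d {S T} → T ≤ S + d → Σ ℕ λ W → W ≤ T × (S < T → S < W) × SplitAt d S W T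
≤⇒splitAt d {S} {T} T≤S+d with T ≤? S + ⌈ d /2⌉
... | yes T≤ = T , ≤-refl , id , T≤ , m≤m+n T ⌊ d /2⌋
≤⇒splitAt zero    T≤S+0 | no T≰ = ⊥-elim (T≰ T≤S+0)
≤⇒splitAt (suc d) {S} {T} T≤S+1+d | no T≰ =
  S + ⌈ suc d /2⌉ , <⇒≤ (≰⇒> T≰) , (λ _ → m<m+n S z<s) , ≤-refl ,
  ≤-trans T≤S+1+d (≤-reflexive (trans (cong (S +_) (sym (⌈n/2⌉+⌊n/2⌋≡n (suc d)))) (sym (+-assoc S _ _))))

¬<⇔splitAt-zero : ∀ {S W T} → (¬ S < W × ¬ W < T) ⇔ SplitAt 0 S W T
¬<⇔splitAt-zero {S} {W} {T} = mk⇔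
  (λ (S≮W , W≮T) → m≤n⇒m≤n+0 (≮⇒≥ S≮W) , m≤n⇒m≤n+0 (≮⇒≥ W≮T))
  (λ (W≤S+0 , T≤W+0) → ≤⇒≯ (m≤n+0⇒m≤n W≤S+0) , ≤⇒≯ (m≤n+0⇒m≤n T≤W+0))
  where
  m≤n⇒m≤n+0 : ∀ {a b} → a ≤ b → a ≤ b + 0
  m≤n⇒m≤n+0 {b = b} = subst (_ ≤_) (sym (+-identityʳ b))

Spec : Quant → ℕ → ℕ → ℕ → ℕ → Set
Spec Q∀ = NearEnd
Spec Q∃ = SplitAt

Halves : Quant → ℕ → ℕ → ℕ → ℕ → ℕ → ℕ → Set
Halves q a b S X T V = (X < V → Spec q b X V T) × (¬ X < V → Spec q a S V X)

choose-side : ∀ d {m S Z T} → Z < T → T ≤ m →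
  (Σ ℕ λ W → W ≤ m × Halves Q∃ ⌊ d /2⌋ ⌈ d /2⌉ S Z T W) ⇔ (Z ≤ S + ⌊ d /2⌋ ⊎ T ≤ Z + ⌈ d /2⌉)
choose-side d {m} {S} {Z} {T} Z<T T≤m = mk⇔
  (λ (W , _ , right , left) →
     [ inj₂ ∘ splitAt⇒≤ ⌈ d /2⌉ ∘ right , inj₁ ∘ splitAt⇒≤ ⌊ d /2⌋ ∘ left ] (toSum (Z <? W)))
  [ left-witness , right-witness ]
  where
  left-witness : Z ≤ S + ⌊ d /2⌋ → Σ ℕ λ W → W ≤ m × Halves Q∃ ⌊ d /2⌋ ⌈ d /2⌉ S Z T W
  left-witness Z≤ = let W , W≤Z , _ , split = ≤⇒splitAt ⌊ d /2⌋ Z≤ in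
    W , ≤-trans W≤Z (≤-trans (<⇒≤ Z<T) T≤m) , (λ Z<W → ⊥-elim (<⇒≱ Z<W W≤Z)) , (λ _ → split)
  right-witness : T ≤ Z + ⌈ d /2⌉ → Σ ℕ λ W → W ≤ m × Halves Q∃ ⌊ d /2⌋ ⌈ d /2⌉ S Z T W
  right-witness T≤ = let W , W≤T , Z<W , split = ≤⇒splitAt ⌈ d /2⌉ T≤ in
    W , ≤-trans W≤T T≤m , (λ _ → split) , (λ Z≮W → ⊥-elim (Z≮W (Z<W Z<T)))

probe-both-sides : ∀ d {m S W T} → W ≤ m → T ≤ m →
  (∀ V → V ≤ m → Halves Q∀ ⌈ d /2⌉ ⌊ d /2⌋ S W T V) ⇔ SplitAt d S W T
probe-both-sides d {m} {S} {W} {T} W≤m T≤m = mk⇔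
  (λ near → left near , right near)
  (λ (W≤ , T≤) V _ → (λ _ → ≤⇒nearEnd ⌊ d /2⌋ T≤) , (λ _ → ≤⇒nearEnd ⌈ d /2⌉ W≤))
  where
  left : (∀ V → V ≤ m → Halves Q∀ ⌈ d /2⌉ ⌊ d /2⌋ S W T V) → W ≤ S + ⌈ d /2⌉
  left near = nearEnd⇒≤ ⌈ d /2⌉
    (λ V _ V<W → proj₂ (near V (≤-trans (<⇒≤ V<W) W≤m)) (<-asym V<W))
    (λ _ → W , proj₂ (near W W≤m) (n≮n W))
  right : (∀ V → V ≤ m → Halves Q∀ ⌈ d /2⌉ ⌊ d /2⌋ S W T V) → T ≤ W + ⌊ d /2⌋
  right near = nearEnd⇒≤ ⌊ d /2⌋
    (λ V W<V V<T → proj₁ (near V (≤-trans (<⇒≤ V<T) T≤m)) W<V)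
    (λ W<T → T , proj₁ (near T T≤m) W<T)

nearEnd-everywhere : ∀ d {m} → (∀ V → V ≤ m → NearEnd d 0 V m) ⇔ m ≤ d
nearEnd-everywhere d = mk⇔
  (λ near → nearEnd⇒≤ d (λ V _ V<m → near V (<⇒≤ V<m)) (λ _ → 0 , near 0 z≤n))
  (λ m≤d V _ → ≤⇒nearEnd d m≤d)

splitAt-somewhere : ∀ d {m} → (Σ ℕ λ W → W ≤ m × SplitAt d 0 W m) ⇔ m ≤ d
splitAt-somewhere d = mk⇔
  (λ (W , _ , split) → splitAt⇒≤ d split)
  (λ m≤d → let W , W≤m , _ , split = ≤⇒splitAt d m≤d in W , W≤m , split)

var₀ : Term (suc n)
var₀ = var fzero

between : Term n → Term n → Term n → QF n
between s x t = (s <' x) ∧' (x <' t)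

-- The quantifier q binding x sits outside body q k d s x t; k counts the
-- quantifiers inside.
mutual
  body : Quant → ℕ → ℕ → Term n → Term n → Term n → Prenex n
  body Q∀ k       zero    s z t = padded (alternation Q∃ k) (¬' (s <' t))
  body Q∀ zero    (suc d) s z t = matrix (¬' between s z t)
  body Q∀ (suc k) (suc d) s z t = between s z t ⇒' ∃' (halves Q∃ k ⌊ d /2⌋ ⌈ d /2⌉ s z t)
  body Q∃ zero    d       s w t = matrix ((¬' (s <' w)) ∧' (¬' (w <' t)))
  body Q∃ (suc k) d       s w t = ∀' (halves Q∀ k ⌈ d /2⌉ ⌊ d /2⌋ s w t)

  halves : Quant → ℕ → ℕ → ℕ → Term n → Term n → Term n → Prenex (suc n)
  halves q k a b s x t =
    if weakenTerm x <' var₀ then body q k b (weakenTerm x) var₀ (weakenTerm t)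
                            else body q k a (weakenTerm s) var₀ (weakenTerm x)

mutual
  prefix-body : ∀ q k d (s x t : Term n) → prefix (body q k d s x t) ≡ alternation (dual q) k
  prefix-body Q∀ k       zero    s z t = prefix-padded (alternation Q∃ k) (¬' (s <' t))
  prefix-body Q∀ zero    (suc d) s z t = refl
  prefix-body Q∀ (suc k) (suc d) s z t =
    trans (prefix-⇒' (between s z t) (∃' (halves Q∃ k ⌊ d /2⌋ ⌈ d /2⌉ s z t)))
          (cong (Q∃ ∷_) (prefix-halves Q∃ k ⌊ d /2⌋ ⌈ d /2⌉ s z t))
  prefix-body Q∃ zero    d       s w t = refl
  prefix-body Q∃ (suc k) d       s w t = cong (Q∀ ∷_) (prefix-halves Q∀ k ⌈ d /2⌉ ⌊ d /2⌋ s w t)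

  prefix-halves : ∀ q k a b (s x t : Term n) → prefix (halves q k a b s x t) ≡ alternation (dual q) k
  prefix-halves q k a b s x t =
    trans (prefix-if (weakenTerm x <' var₀) _ _ (trans right (sym left))) right
    where
    right = prefix-body q k b (weakenTerm x) var₀ (weakenTerm t)
    left  = prefix-body q k a (weakenTerm s) var₀ (weakenTerm x)

bonus : Quant → ℕ
bonus Q∀ = 1
bonus Q∃ = 0

reach : Quant → ℕ → ℕ
reach q zero    = bonus q
reach q (suc k) = bonus q + (reach (dual q) k + reach (dual q) k)

mutual
  ⊨-body : ∀ q k d → d ≤ reach q k → ∀ {s x t : Term n} {ρ : Env m n} {S X T} →
           val s ρ ≡ S → val x ρ ≡ X → val t ρ ≡ T →
           m ⊨ body q k d s x t [ ρ ] ⇔ Spec q d S X T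
  ⊨-body Q∀ k zero _ {s} {t = t} {ρ} refl refl refl =
    mk⇔ ≮⇒≥ ≤⇒≯ ⇔-∘ ⊨-padded (alternation Q∃ k) (¬' (s <' t)) ρ
  ⊨-body Q∀ zero (suc zero) _ refl refl refl = ¬between⇔nearEnd-one
  ⊨-body Q∀ zero (suc (suc d)) (s≤s ())
  ⊨-body {m = m} Q∀ (suc k) (suc d) (s≤s d≤2r) {s} {z} {t} {ρ} refl refl refl =
    mk⇔ (λ f S<Z Z<T → to (side⇔ Z<T) (f (S<Z , Z<T)))
        (λ near (S<Z , Z<T) → from (side⇔ Z<T) (near S<Z Z<T))
    ⇔-∘ ⊨-⇒' (between s z t) (∃' (halves Q∃ k ⌊ d /2⌋ ⌈ d /2⌉ s z t)) ρ
    where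
    side⇔ : val z ρ < val t ρ →
            m ⊨ ∃' (halves Q∃ k ⌊ d /2⌋ ⌈ d /2⌉ s z t) [ ρ ] ⇔
            (val z ρ ≤ val s ρ + ⌊ d /2⌋ ⊎ val t ρ ≤ val z ρ + ⌈ d /2⌉)
    side⇔ Z<T = choose-side d Z<T (val≤m t ρ) ⇔-∘ (∃-Fin⇔ ⇔-∘ Σ-⇔ (↠-id _)
                  (⊨-halves Q∃ k (⌊n/2⌋≤m d≤2r) (⌈n/2⌉≤m d≤2r) {s} {z} {t} {ρ} _))
  ⊨-body Q∃ zero zero _ refl refl refl = ¬<⇔splitAt-zero
  ⊨-body Q∃ (suc k) d d≤2r {s} {w} {t} {ρ} refl refl refl =
    probe-both-sides d (val≤m w ρ) (val≤m t ρ) ⇔-∘ (∀-Fin⇔ ⇔-∘ Π-⇔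
      (⊨-halves Q∀ k (⌈n/2⌉≤m d≤2r) (⌊n/2⌋≤m d≤2r) {s} {w} {t} {ρ}))

  ⊨-halves : ∀ q k {a b} → a ≤ reach q k → b ≤ reach q k → ∀ {s x t : Term n} {ρ : Env m n} v →
             m ⊨ halves q k a b s x t [ extend v ρ ] ⇔ Halves q a b (val s ρ) (val x ρ) (val t ρ) (toℕ v)
  ⊨-halves q k {a} {b} a≤ b≤ {s} {x} {t} {ρ} v =
    cases-⇔ (≡⇒ (cong (_< toℕ v) (val-weaken x v ρ)))
            (⊨-body q k b b≤ (val-weaken x v ρ) refl (val-weaken t v ρ))
            (⊨-body q k a a≤ (val-weaken s v ρ) refl (val-weaken x v ρ))
    ⇔-∘ ⊨-if (weakenTerm x <' var₀) _ _ (extend v ρ)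
             (trans (prefix-body q k b _ _ _) (sym (prefix-body q k a _ _ _)))

length≤ : Quant → ℕ → ℕ → PrenexSentence
length≤ q k ℓ = quantify q (body q k ℓ tmin var₀ tmax)

prefix-length≤ : ∀ q k ℓ → prefix (length≤ q k ℓ) ≡ alternation q (suc k)
prefix-length≤ q k ℓ = trans (prefix-quantify q _) (cong (q ∷_) (prefix-body q k ℓ tmin var₀ tmax))

⊨-length≤ : ∀ q k {ℓ m} → ℓ ≤ reach q k → m ⊨ length≤ q k ℓ ⇔ m ≤ ℓ
⊨-length≤ Q∀ k {ℓ} {m} ℓ≤ = nearEnd-everywhere ℓ ⇔-∘ (∀-Fin⇔ ⇔-∘ Π-⇔ λ _ →
  ⊨-body Q∀ k ℓ ℓ≤ refl refl (Fin.toℕ-fromℕ m))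
⊨-length≤ Q∃ k {ℓ} {m} ℓ≤ = splitAt-somewhere ℓ ⇔-∘ (∃-Fin⇔ ⇔-∘ Σ-⇔ (↠-id _)
  (⊨-body Q∃ k ℓ ℓ≤ refl refl (Fin.toℕ-fromℕ m)))

-- first k leads the alternating prefix of length k that ends with ∀;
-- first 0 is chosen so that first 1 = Q∀.
first : ℕ → Quant
first zero    = Q∃
first (suc k) = dual (first k)

capacity : ℕ → ℕ
capacity zero    = 0
capacity (suc k) = bonus (first (suc k)) + (capacity k + capacity k)

reach-first : ∀ k → reach (first (suc k)) k ≡ capacity (suc k)
reach-first zero    = refl
reach-first (suc k) = cong (λ r → bonus (first (2 + k)) + (r + r))
  (trans (cong (λ q → reach q k) (dual-involutive (first (suc k)))) (reach-first k))

last-alternation-first : ∀ k → last (alternation (first (suc k)) (suc k)) ≡ just Q∀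
last-alternation-first zero    = refl
last-alternation-first (suc k) rewrite dual-involutive (first (suc k)) = last-alternation-first k

length≤-sentence : ∀ k {ℓ} → 1 ≤ ℓ → ℓ ≤ capacity k →
  Σ PrenexSentence λ σ → (∀ m → m ⊨ σ ⇔ m ≤ ℓ)
                        × prefix σ ≡ alternation (first k) k × last (prefix σ) ≡ just Q∀
length≤-sentence zero    1≤ℓ ℓ≤0 = ⊥-elim (<⇒≱ 1≤ℓ ℓ≤0)
length≤-sentence (suc k) {ℓ} _ ℓ≤capacity =
  length≤ q k ℓ ,
  (λ m → ⊨-length≤ q k (subst (ℓ ≤_) (sym (reach-first k)) ℓ≤capacity)) ,
  prefix-length≤ q k ℓ ,
  trans (cong last (prefix-length≤ q k ℓ)) (last-alternation-first k)
  where q = first (suc k)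

module _ (P Q : ℕ → ℕ → Set) (P-1 : P 1 1) (P-2 : P 2 2) (Q-1 : Q 1 2)
         (P-step : ∀ n {k} → Q ⌊ 3 + n /2⌋ k → P (3 + n) (suc k))
         (Q-step : ∀ n {k} → P ⌈ 2 + n /2⌉ k → Q (2 + n) (suc k)) where

  private
    mutual
      q∀f-induction : ∀ f n → 1 ≤ n → n ≤ f → P n (q∀f f n)
      q∀f-induction (suc f) 1 _ _ = P-1
      q∀f-induction (suc f) 2 _ _ = P-2
      q∀f-induction (suc f) (suc (suc (suc n))) _ 3+n≤1+f = P-step n
        (q∃f-induction f ⌊ 3 + n /2⌋ (s≤s z≤n) (≤-pred (<-≤-trans (⌊n/2⌋<n (2 + n)) 3+n≤1+f)))

      q∃f-induction : ∀ f n → 1 ≤ n → n ≤ f → Q n (q∃f f n)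
      q∃f-induction (suc f) 1 _ _ = Q-1
      q∃f-induction (suc f) (suc (suc n)) _ 2+n≤1+f = Q-step n
        (q∀f-induction f ⌈ 2 + n /2⌉ (s≤s z≤n) (≤-pred (<-≤-trans (⌈n/2⌉<n n) 2+n≤1+f)))

  q*-induction : ∀ n → 1 ≤ n → P n (q*∀ n) × Q n (q*∃ n)
  q*-induction n 1≤n = q∀f-induction n n 1≤n ≤-refl , q∃f-induction n n 1≤n ≤-refl

n≤1+⌊n/2⌋+⌊n/2⌋ : ∀ n → n ≤ suc (⌊ n /2⌋ + ⌊ n /2⌋)
n≤1+⌊n/2⌋+⌊n/2⌋ zero          = z≤n
n≤1+⌊n/2⌋+⌊n/2⌋ (suc zero)    = s≤s z≤n
n≤1+⌊n/2⌋+⌊n/2⌋ (suc (suc n)) =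
  s≤s (≤-trans (s≤s (n≤1+⌊n/2⌋+⌊n/2⌋ n)) (≤-reflexive (sym (+-suc (suc ⌊ n /2⌋) ⌊ n /2⌋))))

n≤⌈n/2⌉+⌈n/2⌉ : ∀ n → n ≤ ⌈ n /2⌉ + ⌈ n /2⌉
n≤⌈n/2⌉+⌈n/2⌉ n = ≤-trans (≤-reflexive (sym (⌊n/2⌋+⌈n/2⌉≡n n))) (+-monoˡ-≤ ⌈ n /2⌉ (⌊n/2⌋≤⌈n/2⌉ n))

2*m<n⇐m<⌈n/2⌉ : ∀ {m n} → m < ⌈ n /2⌉ → 2 * m < n
2*m<n⇐m<⌈n/2⌉ {zero}  {suc n}       _        = z<s
2*m<n⇐m<⌈n/2⌉ {suc m} {suc (suc n)} (s≤s m<) =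
  subst (_< 2 + n) (sym (*-suc 2 m)) (s≤s (s≤s (2*m<n⇐m<⌈n/2⌉ m<)))

capacity-step∀ : ∀ q {h c n} → n ≤ suc (h + h) → h + bonus q ≤ c → n ≤ bonus (dual q) + (c + c)
capacity-step∀ Q∀ {h} {c} n≤ h+1≤c = ≤-trans n≤ (+-mono-≤ 1+h≤c (≤-trans (n≤1+n h) 1+h≤c))
  where 1+h≤c = subst (_≤ c) (+-comm h 1) h+1≤c
capacity-step∀ Q∃ {h} {c} n≤ h+0≤c = ≤-trans n≤ (s≤s (+-mono-≤ h≤c h≤c))
  where h≤c = subst (_≤ c) (+-identityʳ h) h+0≤c

capacity-step∃ : ∀ b {c C n} → n ≤ c + c → c ≤ C → n + b ≤ b + (C + C)
capacity-step∃ b {C = C} {n} n≤ c≤C =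
  subst (_≤ b + (C + C)) (+-comm b n) (+-monoʳ-≤ b (≤-trans n≤ (+-mono-≤ c≤C c≤C)))

-- The extra bonus for q*∃ is what the ∀-step needs: when q*∃ ⌊n/2⌋ is odd,
-- one more quantifier only doubles the capacity.
q*-within-capacity : ∀ n → 1 ≤ n →
  n ≤ capacity (q*∀ n) × n + bonus (first (q*∃ n)) ≤ capacity (q*∃ n)
q*-within-capacity = q*-induction
  (λ n k → n ≤ capacity k) (λ n k → n + bonus (first k) ≤ capacity k)
  (s≤s z≤n) (s≤s (s≤s z≤n)) (s≤s z≤n)
  (λ n {k} → capacity-step∀ (first k) (n≤1+⌊n/2⌋+⌊n/2⌋ (3 + n)))
  (λ n {k} → capacity-step∃ (bonus (first (suc k))) (n≤⌈n/2⌉+⌈n/2⌉ (2 + n)))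

q*-exponential : ∀ n → 1 ≤ n →
  (∀ j → q*∀ n ≡ 2 + j → 2 ^ j < n) × (∀ j → q*∃ n ≡ 3 + j → 2 ^ suc j < n)
q*-exponential = q*-induction
  (λ n k → ∀ j → k ≡ 2 + j → 2 ^ j < n) (λ n k → ∀ j → k ≡ 3 + j → 2 ^ suc j < n)
  (λ _ ()) (λ { zero _ → s≤s (s≤s z≤n) }) (λ _ ())
  (λ { n _ zero _ → s≤s (s≤s z≤n)
     ; n _ (suc zero) _ → s≤s (s≤s (s≤s z≤n))
     ; n below (suc (suc j)) eq →
         2*m<n⇐m<⌈n/2⌉ (<-≤-trans (below j (suc-injective eq)) (⌊n/2⌋≤⌈n/2⌉ (3 + n))) })
  (λ n below j eq → 2*m<n⇐m<⌈n/2⌉ (below j (suc-injective eq)))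

≤⌊log₂⌋+2 : ∀ {n} k → (∀ j → k ≡ 2 + j → 2 ^ j < n) → k ≤ ⌊log₂ n ⌋ + 2
≤⌊log₂⌋+2 {n} zero          _    = z≤n
≤⌊log₂⌋+2 {n} (suc zero)    _    = ≤-trans (s≤s z≤n) (m≤n+m 2 ⌊log₂ n ⌋)
≤⌊log₂⌋+2 {n} (suc (suc j)) 2^j< = subst (_≤ ⌊log₂ n ⌋ + 2) (+-comm j 2)
  (+-monoˡ-≤ 2 (subst (_≤ ⌊log₂ n ⌋) (⌊log₂[2^n]⌋≡n j) (⌊log₂⌋-mono-≤ (<⇒≤ (2^j< j refl)))))

q*≤⌊log₂⌋+2 : ∀ ℓ → 1 ≤ ℓ → q* ℓ ≤ ⌊log₂ ℓ ⌋ + 2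
q*≤⌊log₂⌋+2 ℓ 1≤ℓ =
  ≤-trans (m⊓n≤m (q*∀ ℓ) (q*∃ ℓ)) (≤⌊log₂⌋+2 (q*∀ ℓ) (proj₁ (q*-exponential ℓ 1≤ℓ)))

ℓ≤capacity[q*] : ∀ ℓ → 1 ≤ ℓ → ℓ ≤ capacity (q* ℓ)
ℓ≤capacity[q*] ℓ 1≤ℓ with ⊓-sel (q*∀ ℓ) (q*∃ ℓ) | q*-within-capacity ℓ 1≤ℓ
... | inj₁ q*≡q*∀ | fits∀ , _ = subst (λ k → ℓ ≤ capacity k) (sym q*≡q*∀) fits∀
... | inj₂ q*≡q*∃ | _ , fits∃ = subst (λ k → ℓ ≤ capacity k) (sym q*≡q*∃) (≤-trans (m≤m+n ℓ _) fits∃)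

theorem4p6 : (ℓ : ℕ) → 1 ≤ ℓ →
    Σ PrenexSentence λ σ →
      ((m : ℕ) → 1 ≤ m → m ≤ ℓ → m ⊨ σ)
      × ((m : ℕ) → ℓ < m → ¬ (m ⊨ σ))
      × length (prefix σ) ≡ q* ℓ
      × q* ℓ ≤ ⌊log₂ ℓ ⌋ + 2
      × Alternating (prefix σ)
      × last (prefix σ) ≡ just Q∀
theorem4p6 ℓ 1≤ℓ =
  let σ , σ⇔ , prefixσ , lastσ = length≤-sentence (q* ℓ) 1≤ℓ (ℓ≤capacity[q*] ℓ 1≤ℓ)
  in σ
   , (λ m _ m≤ℓ → from (σ⇔ m) m≤ℓ)
   , (λ m ℓ<m ⊨σ → <⇒≱ ℓ<m (to (σ⇔ m) ⊨σ))
   , trans (cong length prefixσ) (length-alternation (first (q* ℓ)) (q* ℓ))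
   , q*≤⌊log₂⌋+2 ℓ 1≤ℓ
   , subst Alternating (sym prefixσ) (alternation-alternating (first (q* ℓ)) (q* ℓ))
   , lastσ
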